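{- Let $L$ be a first-order language, $\Gamma$ a set of unary $L$-types, $\{M_i:i\in I\}$ a family of $L$-structures each omitting every type in $\Gamma$, and $U$ an ultrafilter on $I$, and suppose $\{M_i:i\in I\}$ is $\Gamma$-nice. Let $M_i^*$ be an expansion of $M_i$ by new constants $\{c_j:j<\kappa\}$ such that for each $j<\kappa$ there is a choice function $\mathcal{C}_j$ on $\Gamma$ with $M_i\models\neg\mathcal{C}_j(p)(c_j^{M_i^*})$ for all $p\in\Gamma$ and all $i\in I$ (i.e. $c_j$ omits each type at the same place in all $M_i$). Then $\{M_i^*:i\in I\}$ is $\Gamma$-nice.
   Context: A unary $L$-type is a set of formulas in one free variable $x$. A choice function on $\Gamma$ is a map $\mathcal{C}$ assigning to each $p\in\Gamma$ a formula $\mathcal{C}(p)\in p$. $\prod^\Gamma M_i$ is the set of $f\in\prod_{i\in I}M_i$ for which there are $X_f\in U$ and a choice function $\mathcal{C}$ (a witness for $f$) with $M_i\models\neg\mathcal{C}(p)(f(i))$ for all $p\in\Gamma$ and $i\in X_f$. A family $\{N_i:i\in I\}$ of structures in a language $L'$ is $\Gamma$-nice if for every $L'$-formula $\psi\equiv\exists x\,\phi(x,y_1,\dots,y_n)$ there is a map $g_\psi$ from $n$-tuples of choice functions on $\Gamma$ to choice functions on $\Gamma$ such that for all $f_1,\dots,f_n\in\prod^\Gamma N_i$ with witnesses $\mathcal{C}_1,\dots,\mathcal{C}_n$ and every $i\in I$, if $N_i\models\exists x\,\phi(x,f_1(i),\dots,f_n(i))$ then there is $m\in N_i$ with $N_i\models\phi(m,f_1(i),\dots,f_n(i))\wedge\neg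 g_\psi(\mathcal{C}_1,\dots,\mathcal{C}_n)(p)(m)$ for every $p\in\Gamma$. -}

module Defs where

open import Data.Nat using (ℕ; zero; suc)
open import Data.Fin using (Fin)
open import Data.Vec using (Vec; []; _∷_)
open import Data.Vec.Functional using () renaming (_∷_ to _∷ᶠ_)
open import Data.Product using (Σ; Σ-syntax; _×_; _,_; proj₁)
open import Data.Sum using (_⊎_; inj₁; inj₂)
open import Data.Empty using (⊥)
open import Data.Unit using () renaming (⊤ to ⊤')
open import Relation.Nullary using (¬_)
open import Relation.Binary.PropositionalEquality using (_≡_)

record Language : Set₁ where
  field
    Func : ℕ → Set   -- function symbols of each arity (constants: arity 0)
    Rel  : ℕ → Set
open Language public

-- terms with n free variables (de Bruijn, variable 0 is the "first" one)
data Term (L : Language) (n : ℕ) : Set where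
  var : Fin n → Term L n
  app : ∀ {k} → Func L k → Vec (Term L n) k → Term L n

data Formula (L : Language) : ℕ → Set where
  falsum : ∀ {n} → Formula L n
  _≐_    : ∀ {n} → Term L n → Term L n → Formula L n
  relF   : ∀ {n k} → Rel L k → Vec (Term L n) k → Formula L n
  neg    : ∀ {n} → Formula L n → Formula L n
  _∧'_   : ∀ {n} → Formula L n → Formula L n → Formula L n
  _∨'_   : ∀ {n} → Formula L n → Formula L n → Formula L n
  _⇒'_   : ∀ {n} → Formula L n → Formula L n → Formula L n
  all    : ∀ {n} → Formula L (suc n) → Formula L n
  ex     : ∀ {n} → Formula L (suc n) → Formula L n

record Structure (L : Language) : Set₁ where
  field
    Carrier : Set
    fun : ∀ {k} → Func L k → Vec Carrier k → Carrier
    rel : ∀ {k} → Rel L k → Vec Carrier k → Set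
open Structure public

module _ {L : Language} (M : Structure L) where
  mutual
    evalT : ∀ {n} → Term L n → (Fin n → Carrier M) → Carrier M
    evalT (var x)    ρ = ρ x
    evalT (app f ts) ρ = fun M f (evalTs ts ρ)

    evalTs : ∀ {n k} → Vec (Term L n) k → (Fin n → Carrier M) → Vec (Carrier M) k
    evalTs []       ρ = []
    evalTs (t ∷ ts) ρ = evalT t ρ ∷ evalTs ts ρ

  Sat : ∀ {n} → Formula L n → (Fin n → Carrier M) → Set
  Sat falsum     ρ = ⊥
  Sat (s ≐ t)    ρ = evalT s ρ ≡ evalT t ρ
  Sat (relF R ts) ρ = Structure.rel M R (evalTs ts ρ)
  Sat (neg φ)    ρ = ¬ Sat φ ρ
  Sat (φ ∧' ψ)   ρ = Sat φ ρ × Sat ψ ρ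
  Sat (φ ∨' ψ)   ρ = Sat φ ρ ⊎ Sat ψ ρ
  Sat (φ ⇒' ψ)   ρ = Sat φ ρ → Sat ψ ρ
  Sat (all φ)    ρ = (a : Carrier M) → Sat φ (a ∷ᶠ ρ)
  Sat (ex φ)     ρ = Σ[ a ∈ Carrier M ] Sat φ (a ∷ᶠ ρ)

  Sat₁ : Formula L 1 → Carrier M → Set
  Sat₁ φ a = Sat φ (λ _ → a)

record _⊆L_ (L L' : Language) : Set where
  field
    func : ∀ {k} → Func L k → Func L' k
    relm : ∀ {k} → Rel L k → Rel L' k
open _⊆L_ public

⊆L-refl : ∀ {L} → L ⊆L L
⊆L-refl = record { func = λ f → f ; relm = λ R → R }

module _ {L L' : Language} (ι : L ⊆L L') where
  mutual
    trT : ∀ {n} → Term L n → Term L' n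
    trT (var x)    = var x
    trT (app f ts) = app (func ι f) (trTs ts)

    trTs : ∀ {n k} → Vec (Term L n) k → Vec (Term L' n) k
    trTs []       = []
    trTs (t ∷ ts) = trT t ∷ trTs ts

  trF : ∀ {n} → Formula L n → Formula L' n
  trF falsum     = falsum
  trF (s ≐ t)    = trT s ≐ trT t
  trF (relF R ts) = relF (relm ι R) (trTs ts)
  trF (neg φ)    = neg (trF φ)
  trF (φ ∧' ψ)   = trF φ ∧' trF ψ
  trF (φ ∨' ψ)   = trF φ ∨' trF ψ
  trF (φ ⇒' ψ)   = trF φ ⇒' trF ψ
  trF (all φ)    = all (trF φ)
  trF (ex φ)     = ex (trF φ)

ConstSym : Set → ℕ → Set
ConstSym K zero    = K
ConstSym K (suc _) = ⊥

_+c_ : Language → Set → Language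
L +c K = record { Func = λ k → Func L k ⊎ ConstSym K k ; Rel = Rel L }

+c-incl : ∀ {L K} → L ⊆L (L +c K)
+c-incl = record { func = inj₁ ; relm = λ R → R }

expand : ∀ {L K} (M : Structure L) → (K → Carrier M) → Structure (L +c K)
expand {L} {K} M c = record { Carrier = Carrier M ; fun = f ; rel = Structure.rel M }
  where
  f : ∀ {k} → Func (L +c K) k → Vec (Carrier M) k → Carrier M
  f (inj₁ g) xs = fun M g xs
  f {zero} (inj₂ j) _ = c j

record Ultrafilter (I : Set) : Set₁ where
  field
    Large    : (I → Set) → Set
    full     : Large (λ _ → ⊤')
    proper   : ¬ Large (λ _ → ⊥)
    upward   : ∀ {X Y : I → Set} → (∀ i → X i → Y i) → Large X → Large Y
    meet     : ∀ {X Y : I → Set} → Large X → Large Y → Large (λ i → X i × Y i)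
    ultra    : ∀ (X : I → Set) → Large X ⊎ Large (λ i → ¬ X i)

UType : Language → Set₁
UType L = Formula L 1 → Set

Omits : ∀ {L} → Structure L → UType L → Set
Omits M p = ¬ (Σ[ a ∈ Carrier M ] (∀ φ → p φ → Sat₁ M φ a))

TypeSet : Language → Set₁
TypeSet L = UType L → Set

Choice : ∀ {L} → TypeSet L → Set₁
Choice {L} Γ = (p : UType L) → Γ p → Σ[ φ ∈ Formula L 1 ] p φ

module _ {L L' : Language} (ι : L ⊆L L') (Γ : TypeSet L) {I : Set}
         (U : Ultrafilter I) (N : I → Structure L') where
  open Ultrafilter U

  AvoidsAt : Choice Γ → (i : I) → Carrier (N i) → Set₁
  AvoidsAt C i a = ∀ p (h : Γ p) → ¬ Sat₁ (N i) (trF ι (proj₁ (C p h))) a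

  Witness : ((i : I) → Carrier (N i)) → Choice Γ → Set₁
  Witness f C = Σ[ X ∈ (I → Set) ] (Large X × (∀ i → X i → AvoidsAt C i (f i)))

  ΠΓ : ((i : I) → Carrier (N i)) → Set₁
  ΠΓ f = Σ[ C ∈ Choice Γ ] Witness f C

  Nice : Set₁
  Nice = ∀ (n : ℕ) (φ : Formula L' (suc n)) →
    Σ[ g ∈ ((Fin n → Choice Γ) → Choice Γ) ]
      (∀ (f : Fin n → (i : I) → Carrier (N i)) (C : Fin n → Choice Γ) →
         (∀ k → Witness (f k) (C k)) →
         ∀ (i : I) → Sat (N i) (ex φ) (λ k → f k i) →
         Σ[ m ∈ Carrier (N i) ]
           (Sat (N i) φ (m ∷ᶠ (λ k → f k i)) × AvoidsAt (g C) i m))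

module Submission where

-- An (L + K)-formula φ(x, ȳ) mentions only finitely many occurrences of
-- new constants c_j.  Replacing the k-th occurrence by a fresh variable z_k gives
-- an L-formula ψ(x, ȳ, z̄) such that  M_i* ⊨ φ(a, ȳ)  iff  M_i ⊨ ψ(a, ȳ, c̄).
-- The constants c_j are elements of ∏^Γ M_i, witnessed by their uniform choice
-- functions C_j on all of I, so Γ-niceness of {M_i} applied to ψ with the extra
-- parameters c̄ yields the map for φ:  g_φ(C̄) = g_ψ(C̄, C̄_j).

open import Defs
open import Data.Product using (Σ; Σ-syntax; _,_; proj₁; proj₂; map₂)
open import Data.Product.Function.NonDependent.Propositional using (_×-⇔_)
open import Data.Sum using (inj₁; inj₂)
open import Data.Sum.Function.Propositional using (_⊎-⇔_)
open import Data.Nat using (ℕ; zero; suc; _+_)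
open import Data.Fin using (Fin; zero; suc; splitAt; _↑ˡ_; _↑ʳ_; lift)
open import Data.Vec using (Vec; []; _∷_)
open import Data.Vec.Functional using (Vector; _++_; take; drop) renaming (_∷_ to _∷ᶠ_)
open import Data.Vec.Functional.Properties using (lookup-++ˡ; lookup-++ʳ)
open import Data.Unit using (⊤)
open import Function using (_∘_)
open import Function.Bundles using (_⇔_; mk⇔; module Equivalence)
open import Function.Construct.Identity using (⇔-id)
open import Function.Related.TypeIsomorphisms using (→-cong-⇔; ¬-cong-⇔)
open import Level using (Level)
open import Relation.Nullary using (¬_)
open import Relation.Binary.PropositionalEquality using (_≡_; refl; trans; cong; cong₂)

open Equivalence using (to; from)

module _ {a b : Level} {A : Set a} {B C : A → Set b} where

  Π-cong-⇔ : (∀ x → B x ⇔ C x) → ((x : A) → B x) ⇔ ((x : A) → C x)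
  Π-cong-⇔ B⇔C = mk⇔ (λ f x → to (B⇔C x) (f x)) (λ g x → from (B⇔C x) (g x))

  Σ-cong-⇔ : (∀ x → B x ⇔ C x) → Σ A B ⇔ Σ A C
  Σ-cong-⇔ B⇔C = mk⇔ (map₂ (to (B⇔C _))) (map₂ (from (B⇔C _)))

module _ {a : Level} {A : Set a} where

  ≡-cong-⇔ : {x x' y y' : A} → x ≡ x' → y ≡ y' → (x ≡ y) ⇔ (x' ≡ y')
  ≡-cong-⇔ refl refl = ⇔-id _

  pred-cong-⇔ : (P : A → Set) {x y : A} → x ≡ y → P x ⇔ P y
  pred-cong-⇔ P refl = ⇔-id _

reduct : {L L' : Language} → L ⊆L L' → Structure L' → Structure L
reduct ι N = record
  { Carrier = Carrier N
  ; fun     = λ f → fun N (func ι f)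
  ; rel     = λ R → Structure.rel N (relm ι R)
  }

module _ {L L' : Language} (ι : L ⊆L L') (N : Structure L') where

  mutual
    translate-evalT : ∀ {n} (t : Term L n) ρ →
      evalT N (trT ι t) ρ ≡ evalT (reduct ι N) t ρ
    translate-evalT (var x)    ρ = refl
    translate-evalT (app f ts) ρ = cong (fun N (func ι f)) (translate-evalTs ts ρ)

    translate-evalTs : ∀ {n k} (ts : Vec (Term L n) k) ρ →
      evalTs N (trTs ι ts) ρ ≡ evalTs (reduct ι N) ts ρ
    translate-evalTs []       ρ = refl
    translate-evalTs (t ∷ ts) ρ = cong₂ _∷_ (translate-evalT t ρ) (translate-evalTs ts ρ)

  translate-sat : ∀ {n} (φ : Formula L n) ρ →
    Sat N (trF ι φ) ρ ⇔ Sat (reduct ι N) φ ρ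
  translate-sat falsum      ρ = ⇔-id _
  translate-sat (s ≐ t)     ρ = ≡-cong-⇔ (translate-evalT s ρ) (translate-evalT t ρ)
  translate-sat (relF R ts) ρ = pred-cong-⇔ (Structure.rel N (relm ι R)) (translate-evalTs ts ρ)
  translate-sat (neg φ)     ρ = ¬-cong-⇔ (translate-sat φ ρ)
  translate-sat (φ ∧' ψ)    ρ = translate-sat φ ρ ×-⇔ translate-sat ψ ρ
  translate-sat (φ ∨' ψ)    ρ = translate-sat φ ρ ⊎-⇔ translate-sat ψ ρ
  translate-sat (φ ⇒' ψ)    ρ = →-cong-⇔ (translate-sat φ ρ) (translate-sat ψ ρ)
  translate-sat (all φ)     ρ = Π-cong-⇔ λ a → translate-sat φ (a ∷ᶠ ρ)
  translate-sat (ex φ)      ρ = Σ-cong-⇔ λ a → translate-sat φ (a ∷ᶠ ρ)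

Avoids : {L : Language} {Γ : TypeSet L} (M : Structure L) → Choice Γ → Carrier M → Set₁
Avoids M C a = ∀ p h → ¬ Sat₁ M (proj₁ (C p h)) a

module _ {L L' : Language} (ι : L ⊆L L') (Γ : TypeSet L) {I : Set}
         (U : Ultrafilter I) (N : I → Structure L') where

  avoidsAt⇔avoids : ∀ C i a → AvoidsAt ι Γ U N C i a ⇔ Avoids (reduct ι (N i)) C a
  avoidsAt⇔avoids C i a = Π-cong-⇔ λ p → Π-cong-⇔ λ h →
    ¬-cong-⇔ (translate-sat ι (N i) (proj₁ (C p h)) (λ _ → a))

module _ {L L' : Language} (ι : L ⊆L L') (Γ : TypeSet L) {I : Set}
         (U : Ultrafilter I) (N : I → Structure L') where

  avoidsAt-reduct : ∀ C i a →
    AvoidsAt ⊆L-refl Γ U (λ i → reduct ι (N i)) C i a ⇔ AvoidsAt ι Γ U N C i a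
  avoidsAt-reduct C i a = mk⇔
    (from (avoidsAt⇔avoids ι Γ U N C i a) ∘ to (avoidsAt⇔avoids ⊆L-refl Γ U N' C i a))
    (from (avoidsAt⇔avoids ⊆L-refl Γ U N' C i a) ∘ to (avoidsAt⇔avoids ι Γ U N C i a))
    where N' = λ i → reduct ι (N i)

  witness-reduct : ∀ f C → Witness ι Γ U N f C →
    Witness ⊆L-refl Γ U (λ i → reduct ι (N i)) f C
  witness-reduct f C (X , X-large , avoids) =
    X , X-large , λ i i∈X → from (avoidsAt-reduct C i (f i)) (avoids i i∈X)

  open Ultrafilter U

  uniform-witness : ∀ f C → (∀ i → Avoids (reduct ι (N i)) C (f i)) → Witness ι Γ U N f C
  uniform-witness f C avoids =
    (λ _ → ⊤) , full , λ i _ → from (avoidsAt⇔avoids ι Γ U N C i (f i)) (avoids i)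

  ++-witness : ∀ {m n} (A : Vector ((i : I) → Carrier (N i)) m) (CA : Vector (Choice Γ) m)
    (B : Vector ((i : I) → Carrier (N i)) n) (CB : Vector (Choice Γ) n) →
    (∀ k → Witness ι Γ U N (A k) (CA k)) → (∀ k → Witness ι Γ U N (B k) (CB k)) →
    ∀ x → Witness ι Γ U N ((A ++ B) x) ((CA ++ CB) x)
  ++-witness {m} A CA B CB wA wB x with splitAt m x
  ... | inj₁ k = wA k
  ... | inj₂ k = wB k

module Abstraction {L : Language} {K : Set} where

  -- The occurrences of new constants in a term (list), in left-to-right order:
  -- how many there are, and which constant each one is.
  mutual
    #constsT : ∀ {n} → Term (L +c K) n → ℕ
    #constsT (var x)                  = 0
    #constsT (app (inj₁ f) ts)        = #constsTs ts
    #constsT (app {zero} (inj₂ j) ts) = 1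
    #constsT (app {suc _} (inj₂ ()) ts)

    #constsTs : ∀ {n k} → Vec (Term (L +c K) n) k → ℕ
    #constsTs []       = 0
    #constsTs (t ∷ ts) = #constsT t + #constsTs ts

  mutual
    constsT : ∀ {n} (t : Term (L +c K) n) → Vector K (#constsT t)
    constsT (var x) ()
    constsT (app (inj₁ f) ts)          = constsTs ts
    constsT (app {zero} (inj₂ j) ts) _ = j
    constsT (app {suc _} (inj₂ ()) ts)

    constsTs : ∀ {n k} (ts : Vec (Term (L +c K) n) k) → Vector K (#constsTs ts)
    constsTs []       ()
    constsTs (t ∷ ts) = constsT t ++ constsTs ts

  -- Rename the variables by e and replace the k-th constant occurrence by o k.
  mutual
    abstractT : ∀ {n N} (t : Term (L +c K) n) →
      (Fin n → Fin N) → Vector (Fin N) (#constsT t) → Term L N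
    abstractT (var x)                  e o = var (e x)
    abstractT (app (inj₁ f) ts)        e o = app f (abstractTs ts e o)
    abstractT (app {zero} (inj₂ j) ts) e o = var (o zero)
    abstractT (app {suc _} (inj₂ ()) ts)

    abstractTs : ∀ {n N k} (ts : Vec (Term (L +c K) n) k) →
      (Fin n → Fin N) → Vector (Fin N) (#constsTs ts) → Vec (Term L N) k
    abstractTs []       e o = []
    abstractTs (t ∷ ts) e o =
      abstractT t e (take (#constsT t) o) ∷ abstractTs ts e (drop (#constsT t) o)

  #constsF : ∀ {n} → Formula (L +c K) n → ℕ
  #constsF falsum      = 0
  #constsF (s ≐ t)     = #constsT s + #constsT t
  #constsF (relF R ts) = #constsTs ts
  #constsF (neg φ)     = #constsF φ
  #constsF (φ ∧' ψ)    = #constsF φ + #constsF ψ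
  #constsF (φ ∨' ψ)    = #constsF φ + #constsF ψ
  #constsF (φ ⇒' ψ)    = #constsF φ + #constsF ψ
  #constsF (all φ)     = #constsF φ
  #constsF (ex φ)      = #constsF φ

  constsF : ∀ {n} (φ : Formula (L +c K) n) → Vector K (#constsF φ)
  constsF falsum      ()
  constsF (s ≐ t)     = constsT s ++ constsT t
  constsF (relF R ts) = constsTs ts
  constsF (neg φ)     = constsF φ
  constsF (φ ∧' ψ)    = constsF φ ++ constsF ψ
  constsF (φ ∨' ψ)    = constsF φ ++ constsF ψ
  constsF (φ ⇒' ψ)    = constsF φ ++ constsF ψ
  constsF (all φ)     = constsF φ
  constsF (ex φ)      = constsF φ

  abstractF : ∀ {n N} (φ : Formula (L +c K) n) →
    (Fin n → Fin N) → Vector (Fin N) (#constsF φ) → Formula L N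
  abstractF falsum      e o = falsum
  abstractF (s ≐ t)     e o = abstractT s e (take (#constsT s) o) ≐ abstractT t e (drop (#constsT s) o)
  abstractF (relF R ts) e o = relF R (abstractTs ts e o)
  abstractF (neg φ)     e o = neg (abstractF φ e o)
  abstractF (φ ∧' ψ)    e o = abstractF φ e (take (#constsF φ) o) ∧' abstractF ψ e (drop (#constsF φ) o)
  abstractF (φ ∨' ψ)    e o = abstractF φ e (take (#constsF φ) o) ∨' abstractF ψ e (drop (#constsF φ) o)
  abstractF (φ ⇒' ψ)    e o = abstractF φ e (take (#constsF φ) o) ⇒' abstractF ψ e (drop (#constsF φ) o)
  abstractF (all φ)     e o = all (abstractF φ (lift 1 e) (λ k → suc (o k)))
  abstractF (ex φ)      e o = ex (abstractF φ (lift 1 e) (λ k → suc (o k)))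

  -- The constant-free form ψ(x, ȳ, z̄) of φ(x, ȳ): the constants become the
  -- variables placed after ȳ.
  abstractConsts : ∀ {n} (φ : Formula (L +c K) (suc n)) → Formula L (suc (n + #constsF φ))
  abstractConsts {n} φ = abstractF φ (lift 1 (_↑ˡ #constsF φ)) (λ k → suc (n ↑ʳ k))

  module _ (M : Structure L) (c : K → Carrier M) where

    Agrees : ∀ {n N} → Vector (Carrier M) N → (Fin n → Fin N) → Vector (Carrier M) n → Set
    Agrees σ e ρ = ∀ x → σ (e x) ≡ ρ x

    agrees-lift : ∀ {n N} {σ : Vector (Carrier M) N} {e : Fin n → Fin N} {ρ} a →
      Agrees σ e ρ → Agrees (a ∷ᶠ σ) (lift 1 e) (a ∷ᶠ ρ)
    agrees-lift a agree zero    = refl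
    agrees-lift a agree (suc x) = agree x

    Fills : ∀ {m N} → Vector (Carrier M) N → Vector (Fin N) m → Vector K m → Set
    Fills σ o js = ∀ k → σ (o k) ≡ c (js k)

    fills-take : ∀ {a b N} (σ : Vector (Carrier M) N) (o : Vector (Fin N) (a + b)) A B →
      Fills σ o (A ++ B) → Fills σ (take a o) A
    fills-take {b = b} σ o A B fill k = trans (fill (k ↑ˡ b)) (cong c (lookup-++ˡ A B k))

    fills-drop : ∀ {a b N} (σ : Vector (Carrier M) N) (o : Vector (Fin N) (a + b)) A B →
      Fills σ o (A ++ B) → Fills σ (drop a o) B
    fills-drop {a} σ o A B fill k = trans (fill (a ↑ʳ k)) (cong c (lookup-++ʳ A B k))

    mutual
      abstract-evalT : ∀ {n N} (t : Term (L +c K) n) e o (σ : Vector (Carrier M) N) ρ →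
        Agrees σ e ρ → Fills σ o (constsT t) →
        evalT M (abstractT t e o) σ ≡ evalT (expand M c) t ρ
      abstract-evalT (var x)                  e o σ ρ agree fill = agree x
      abstract-evalT (app (inj₁ f) ts)        e o σ ρ agree fill =
        cong (fun M f) (abstract-evalTs ts e o σ ρ agree fill)
      abstract-evalT (app {zero} (inj₂ j) []) e o σ ρ agree fill = fill zero
      abstract-evalT (app {suc _} (inj₂ ()) ts)

      abstract-evalTs : ∀ {n N k} (ts : Vec (Term (L +c K) n) k) e o (σ : Vector (Carrier M) N) ρ →
        Agrees σ e ρ → Fills σ o (constsTs ts) →
        evalTs M (abstractTs ts e o) σ ≡ evalTs (expand M c) ts ρ
      abstract-evalTs []       e o σ ρ agree fill = refl
      abstract-evalTs (t ∷ ts) e o σ ρ agree fill = cong₂ _∷_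
        (abstract-evalT t e _ σ ρ agree (fills-take σ o (constsT t) (constsTs ts) fill))
        (abstract-evalTs ts e _ σ ρ agree (fills-drop σ o (constsT t) (constsTs ts) fill))

    abstract-sat : ∀ {n N} (φ : Formula (L +c K) n) e o (σ : Vector (Carrier M) N) ρ →
      Agrees σ e ρ → Fills σ o (constsF φ) →
      Sat M (abstractF φ e o) σ ⇔ Sat (expand M c) φ ρ
    abstract-sat falsum      e o σ ρ agree fill = ⇔-id _
    abstract-sat (s ≐ t)     e o σ ρ agree fill = ≡-cong-⇔
      (abstract-evalT s e _ σ ρ agree (fills-take σ o (constsT s) (constsT t) fill))
      (abstract-evalT t e _ σ ρ agree (fills-drop σ o (constsT s) (constsT t) fill))
    abstract-sat (relF R ts) e o σ ρ agree fill =
      pred-cong-⇔ (Structure.rel M R) (abstract-evalTs ts e o σ ρ agree fill)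
    abstract-sat (neg φ)     e o σ ρ agree fill = ¬-cong-⇔ (abstract-sat φ e o σ ρ agree fill)
    abstract-sat (φ ∧' ψ)    e o σ ρ agree fill =
      abstract-sat φ e _ σ ρ agree (fills-take σ o (constsF φ) (constsF ψ) fill)
        ×-⇔ abstract-sat ψ e _ σ ρ agree (fills-drop σ o (constsF φ) (constsF ψ) fill)
    abstract-sat (φ ∨' ψ)    e o σ ρ agree fill =
      abstract-sat φ e _ σ ρ agree (fills-take σ o (constsF φ) (constsF ψ) fill)
        ⊎-⇔ abstract-sat ψ e _ σ ρ agree (fills-drop σ o (constsF φ) (constsF ψ) fill)
    abstract-sat (φ ⇒' ψ)    e o σ ρ agree fill = →-cong-⇔
      (abstract-sat φ e _ σ ρ agree (fills-take σ o (constsF φ) (constsF ψ) fill))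
      (abstract-sat ψ e _ σ ρ agree (fills-drop σ o (constsF φ) (constsF ψ) fill))
    abstract-sat (all φ)     e o σ ρ agree fill = Π-cong-⇔ λ a →
      abstract-sat φ (lift 1 e) (λ k → suc (o k)) (a ∷ᶠ σ) (a ∷ᶠ ρ) (agrees-lift a agree) fill
    abstract-sat (ex φ)      e o σ ρ agree fill = Σ-cong-⇔ λ a →
      abstract-sat φ (lift 1 e) (λ k → suc (o k)) (a ∷ᶠ σ) (a ∷ᶠ ρ) (agrees-lift a agree) fill

    abstractConsts-sat : ∀ {n} (φ : Formula (L +c K) (suc n)) a ρ σ →
      Agrees σ (_↑ˡ #constsF φ) ρ → Fills σ (n ↑ʳ_) (constsF φ) →
      Sat M (abstractConsts φ) (a ∷ᶠ σ) ⇔ Sat (expand M c) φ (a ∷ᶠ ρ)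
    abstractConsts-sat φ a ρ σ agree fill =
      abstract-sat φ _ _ (a ∷ᶠ σ) (a ∷ᶠ ρ) (agrees-lift a agree) fill

proposition2p18 : (L : Language) (Γ : TypeSet L) (I : Set) (M : I → Structure L)
    (U : Ultrafilter I) →
    (∀ i (p : UType L) → Γ p → Omits (M i) p) →
    Nice ⊆L-refl Γ U M →
    (K : Set) (c : K → (i : I) → Carrier (M i)) →
    (∀ (j : K) → Σ[ C ∈ Choice Γ ]
        (∀ (p : UType L) (h : Γ p) (i : I) →
           ¬ Sat₁ (M i) (Σ.proj₁ (C p h)) (c j i))) →
    Nice (+c-incl {L} {K}) Γ U (λ i → expand (M i) (λ j → c j i))
proposition2p18 L Γ I M U _ nice K c uniform n φ = g , λ f C wit i (a , φ-sat) →
  let wits = ++-witness ⊆L-refl Γ U M f C cs Cs (reduct-witnesses f C wit) cs-witness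
      (b , ψ-sat , avoids) = proj₂ (nice (n + m) (abstractConsts φ))
                               (f ++ cs) (C ++ Cs) wits i (a , from (ψ⇔φ f i a) φ-sat)
  in b , to (ψ⇔φ f i b) ψ-sat , to (avoidsAt-reduct +c-incl Γ U M* (g C) i b) avoids
  where
  open Abstraction {L} {K}
  M* : I → Structure (L +c K)
  M* i = expand (M i) (λ j → c j i)
  m : ℕ
  m = #constsF φ
  Family : ℕ → Set
  Family k = Vector ((i : I) → Carrier (M i)) k
  cs : Family m
  cs k = c (constsF φ k)
  Cs : Vector (Choice Γ) m
  Cs k = proj₁ (uniform (constsF φ k))
  cs-witness : ∀ k → Witness ⊆L-refl Γ U M (cs k) (Cs k)
  cs-witness k = uniform-witness ⊆L-refl Γ U M (cs k) (Cs k)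
    λ i p h → proj₂ (uniform (constsF φ k)) p h i
  reduct-witnesses : ∀ f C → (∀ k → Witness +c-incl Γ U M* (f k) (C k)) →
    ∀ k → Witness ⊆L-refl Γ U M (f k) (C k)
  reduct-witnesses f C wit k = witness-reduct +c-incl Γ U M* (f k) (C k) (wit k)
  ψ⇔φ : (f : Family n) (i : I) (b : Carrier (M i)) →
    Sat (M i) (abstractConsts φ) (b ∷ᶠ λ k → (f ++ cs) k i) ⇔ Sat (M* i) φ (b ∷ᶠ λ k → f k i)
  ψ⇔φ f i b = abstractConsts-sat (M i) (λ j → c j i) φ b (λ k → f k i) (λ k → (f ++ cs) k i)
    (λ k → cong (λ h → h i) (lookup-++ˡ f cs k))
    (λ k → cong (λ h → h i) (lookup-++ʳ f cs k))
  gψ : (Fin (n + m) → Choice Γ) → Choice Γ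
  gψ = proj₁ (nice (n + m) (abstractConsts φ))
  g : (Fin n → Choice Γ) → Choice Γ
  g C = gψ (C ++ Cs)
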